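{- Let $A$ be a commutative unitary ring, $u\in U(A)$ and $n\ge1$ odd. Then the set $R_n^{u}(A)=\{(a_1,\dots,a_n)\in A^n : K_n(a_1,\dots,a_n)=u\}$ has the same cardinality as $\Omega_{n+2}^{\mathrm{Id}}(A)=\{(a_1,\dots,a_{n+2})\in A^{n+2} : M_{n+2}(a_1,\dots,a_{n+2})=\mathrm{Id}\}$.
   Context: $U(A)$ is the unit group of $A$. The continuants are defined by $K_{ -1}:=0_A$, $K_0:=1_A$, and for $i\ge1$, $K_i(X_1,\dots,X_i)$ is the determinant of the $i\times i$ tridiagonal matrix with diagonal $X_1,\dots,X_i$ and all entries on the sub- and super-diagonal equal to $1_A$. $M_{n}(a_1,\ldots,a_n):=\begin{pmatrix} a_{n} & -1_{A} \\ 1_{A} & 0_{A}\end{pmatrix}\cdots\begin{pmatrix} a_{1} & -1_{A} \\ 1_{A} & 0_{A}\end{pmatrix}$; $\mathrm{Id}$ is the $2\times2$ identity matrix. -}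

module Defs where

open import Level using (Level; _⊔_)
open import Algebra.Bundles using (CommutativeRing)
open import Data.Nat using (ℕ; zero; suc)
open import Data.Vec using (Vec; []; _∷_)
open import Data.Product using (Σ; ∃; _×_; proj₁)
open import Relation.Binary.Bundles using (Setoid)
import Data.Vec.Relation.Binary.Pointwise.Inductive as VP
import Relation.Binary.Construct.On as On

module _ {c ℓ : Level} (R : CommutativeRing c ℓ) where
  open CommutativeRing R

  IsUnit : Carrier → Set (c ⊔ ℓ)
  IsUnit u = ∃ λ v → u * v ≈ 1#

  -- Continuants K_i(X_1,…,X_i), the tridiagonal determinant, computed by
  -- Laplace expansion along the first row:
  -- K_0 = 1, K_1(x) = x, K_i(x₁,…,x_i) = x₁ K_{i-1}(x₂,…) - K_{i-2}(x₃,…)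
  K : ∀ {n} → Vec Carrier n → Carrier
  K [] = 1#
  K (x ∷ []) = x
  K (x ∷ y ∷ v) = x * K (y ∷ v) - K v

  record Mat2 : Set c where
    constructor mat
    field
      m11 m12 m21 m22 : Carrier

  _⊗_ : Mat2 → Mat2 → Mat2
  mat a b c' d ⊗ mat e f g h =
    mat (a * e + b * g) (a * f + b * h) (c' * e + d * g) (c' * f + d * h)

  Id : Mat2
  Id = mat 1# 0# 0# 1#

  _≈M_ : Mat2 → Mat2 → Set ℓ
  mat a b c' d ≈M mat e f g h = (a ≈ e) × (b ≈ f) × (c' ≈ g) × (d ≈ h)

  E : Carrier → Mat2
  E a = mat a (- 1#) 1# 0#

  -- M_n(a₁,…,a_n) = E(a_n) ⋯ E(a₁)
  M : ∀ {n} → Vec Carrier n → Mat2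
  M [] = Id
  M (a ∷ v) = M v ⊗ E a

  Aⁿ : ℕ → Setoid c (c ⊔ ℓ)
  Aⁿ n = VP.setoid setoid n

  SubSetoid : (n : ℕ) → (Vec Carrier n → Set ℓ) → Setoid (c ⊔ ℓ) (c ⊔ ℓ)
  SubSetoid n P = On.setoid {B = Σ (Vec Carrier n) P} (Aⁿ n) proj₁

  Rset : (n : ℕ) → Carrier → Setoid (c ⊔ ℓ) (c ⊔ ℓ)
  Rset n u = SubSetoid n (λ v → K v ≈ u)

  Ωset : (n : ℕ) → Setoid (c ⊔ ℓ) (c ⊔ ℓ)
  Ωset n = SubSetoid n (λ v → M v ≈M Id)

-- M_n(a) has determinant 1 and (1,1)-entry K_n(a).  Since M_{n+2}(a,x,y) =
-- E(y)E(x)M_n(a), the word (a,x,y) lies in Ω_{n+2} iff E(y)E(x) = ((xy-1, -y), (x, -1))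
-- is the inverse, i.e. the adjugate, of M_n(a); that is iff K_n(a) = -1, x = -m21
-- and y = m12.  So dropping the last two entries is a bijection Ω_{n+2} → R_n^{-1}.
-- For odd n and uv = 1, multiplying the entries alternately by -v and -u multiplies
-- K_n by -v, which gives R_n^u ≅ R_n^{-1}.
module Submission where

open import Level using (Level; _⊔_)
open import Algebra.Bundles using (CommutativeRing)
open import Algebra.Solver.Ring.AlmostCommutativeRing
  using (fromCommutativeRing; _-Raw-AlmostCommutative⟶_)
import Algebra.Solver.Ring
open import Data.Maybe using (Maybe; just; nothing)
open import Data.Nat as ℕ using (ℕ; zero; suc)
open import Data.Nat.Properties using (+-suc)
open import Data.Integer as ℤ using (ℤ; +_; -[1+_]; _⊖_)
import Data.Integer.Properties as ℤ
import Data.Integer.Tactic.RingSolver as ℤ-Solver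
open import Data.Product using (Σ; _×_; _,_; proj₁; proj₂)
open import Data.Vec using (Vec; []; _∷_; _++_; take; drop)
open import Data.Vec.Properties using (take++drop≡id; ++-injectiveˡ)
open import Data.Vec.Relation.Binary.Pointwise.Inductive as Pointwise using (Pointwise; ++⁺)
open import Function.Bundles using (Inverse; Bijection)
open import Function.Properties.Inverse using (Inverse⇒Bijection)
import Function.Construct.Composition as Composition
open import Relation.Binary.Bundles using (Setoid)
open import Relation.Binary.Core using (Rel)
open import Relation.Binary.PropositionalEquality as ≡ using (_≡_)
open import Relation.Nullary using (yes; no)

open import Defs

take⁺ : ∀ {a r} {A : Set a} {_∼_ : Rel A r} m {n} {v w : Vec A (m ℕ.+ n)} →
        Pointwise _∼_ v w → Pointwise _∼_ (take m v) (take m w)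
take⁺ zero    _                       = Pointwise.[]
take⁺ (suc m) (x∼y Pointwise.∷ v∼w) = x∼y Pointwise.∷ take⁺ m v∼w

take-++ : ∀ {a} {A : Set a} {m n} (v : Vec A m) (w : Vec A n) → take m (v ++ w) ≡ v
take-++ {m = m} v w = ++-injectiveˡ (take m (v ++ w)) v (take++drop≡id m (v ++ w))

private
  module _ where
    open ≡.≡-Reasoning

    ⊖-as-difference : ∀ m n → m ⊖ n ≡ + m ℤ.- + n
    ⊖-as-difference m n = ≡.sym (ℤ.[+m]-[+n]≡m⊖n m n)

    difference-+ : ∀ p q r s → (p ℤ.- q) ℤ.+ (r ℤ.- s) ≡ (p ℤ.+ r) ℤ.- (q ℤ.+ s)
    difference-+ = ℤ-Solver.solve-∀

    difference-* : ∀ p q r s →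
      (p ℤ.- q) ℤ.* (r ℤ.- s) ≡ (p ℤ.* r ℤ.+ q ℤ.* s) ℤ.- (p ℤ.* s ℤ.+ q ℤ.* r)
    difference-* = ℤ-Solver.solve-∀

    pos-*-+-* : ∀ a b c d → + (a ℕ.* b ℕ.+ c ℕ.* d) ≡ + a ℤ.* + b ℤ.+ + c ℤ.* + d
    pos-*-+-* a b c d =
      ≡.trans (ℤ.pos-+ (a ℕ.* b) (c ℕ.* d)) (≡.cong₂ ℤ._+_ (ℤ.pos-* a b) (ℤ.pos-* c d))

    ⊖-+-⊖ : ∀ a b c d → (a ⊖ b) ℤ.+ (c ⊖ d) ≡ (a ℕ.+ c) ⊖ (b ℕ.+ d)
    ⊖-+-⊖ a b c d = begin
      (a ⊖ b) ℤ.+ (c ⊖ d)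
        ≡⟨ ≡.cong₂ ℤ._+_ (⊖-as-difference a b) (⊖-as-difference c d) ⟩
      (+ a ℤ.- + b) ℤ.+ (+ c ℤ.- + d)
        ≡⟨ difference-+ (+ a) (+ b) (+ c) (+ d) ⟩
      (+ a ℤ.+ + c) ℤ.- (+ b ℤ.+ + d)
        ≡⟨ ≡.cong₂ ℤ._-_ (ℤ.pos-+ a c) (ℤ.pos-+ b d) ⟨
      + (a ℕ.+ c) ℤ.- + (b ℕ.+ d)
        ≡⟨ ⊖-as-difference (a ℕ.+ c) (b ℕ.+ d) ⟨
      (a ℕ.+ c) ⊖ (b ℕ.+ d) ∎

    ⊖-*-⊖ : ∀ a b c d →
            (a ⊖ b) ℤ.* (c ⊖ d) ≡ (a ℕ.* c ℕ.+ b ℕ.* d) ⊖ (a ℕ.* d ℕ.+ b ℕ.* c)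
    ⊖-*-⊖ a b c d = begin
      (a ⊖ b) ℤ.* (c ⊖ d)
        ≡⟨ ≡.cong₂ ℤ._*_ (⊖-as-difference a b) (⊖-as-difference c d) ⟩
      (+ a ℤ.- + b) ℤ.* (+ c ℤ.- + d)
        ≡⟨ difference-* (+ a) (+ b) (+ c) (+ d) ⟩
      (+ a ℤ.* + c ℤ.+ + b ℤ.* + d) ℤ.- (+ a ℤ.* + d ℤ.+ + b ℤ.* + c)
        ≡⟨ ≡.cong₂ ℤ._-_ (pos-*-+-* a c b d) (pos-*-+-* a d b c) ⟨
      + (a ℕ.* c ℕ.+ b ℕ.* d) ℤ.- + (a ℕ.* d ℕ.+ b ℕ.* c)
        ≡⟨ ⊖-as-difference (a ℕ.* c ℕ.+ b ℕ.* d) (a ℕ.* d ℕ.+ b ℕ.* c) ⟨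
      (a ℕ.* c ℕ.+ b ℕ.* d) ⊖ (a ℕ.* d ℕ.+ b ℕ.* c) ∎

-- Every commutative ring receives the canonical map from ℤ, so the ring solver
-- with integer coefficients applies to it.
module CommutativeRingSolver {c ℓ : Level} (R : CommutativeRing c ℓ) where
  open CommutativeRing R
  open import Relation.Binary.Reasoning.Setoid setoid
  open import Algebra.Properties.Semiring.Mult.TCOptimised semiring
    using (1+×; ×-homo-+; ×1-homo-*) renaming (_×_ to _×ᴿ_)
  open import Algebra.Properties.Ring ring
    using (-‿+-comm; ⁻¹-anti-homo‿-; x[y-z]≈xy-xz; [y-z]x≈yx-zx; -0#≈0#)
  open import Algebra.Properties.CommutativeSemigroup +-commutativeSemigroup
    using (interchange)

  ⟦_⟧ : ℤ → Carrier
  ⟦ + n ⟧      = n ×ᴿ 1#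
  ⟦ -[1+ n ] ⟧ = - (suc n ×ᴿ 1#)

  private
    ι : ℕ → Carrier
    ι n = n ×ᴿ 1#

    [x+z]-[y+w]≈[x-y]+[z-w] : ∀ x y z w → (x + z) - (y + w) ≈ (x - y) + (z - w)
    [x+z]-[y+w]≈[x-y]+[z-w] x y z w =
      trans (+-congˡ (sym (-‿+-comm y w))) (interchange x z (- y) (- w))

    [xz+yw]-[xw+yz]≈[x-y][z-w] : ∀ x y z w →
                                 (x * z + y * w) - (x * w + y * z) ≈ (x - y) * (z - w)
    [xz+yw]-[xw+yz]≈[x-y][z-w] x y z w = begin
      (x * z + y * w) - (x * w + y * z)        ≈⟨ +-congˡ (-‿+-comm _ _) ⟨
      (x * z + y * w) + (- (x * w) + - (y * z)) ≈⟨ interchange _ _ _ _ ⟩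
      (x * z - x * w) + (y * w - y * z)        ≈⟨ +-congˡ (⁻¹-anti-homo‿- _ _) ⟨
      (x * z - x * w) - (y * z - y * w)
        ≈⟨ +-cong (x[y-z]≈xy-xz x z w) (-‿cong (x[y-z]≈xy-xz y z w)) ⟨
      x * (z - w) - y * (z - w)                ≈⟨ [y-z]x≈yx-zx _ _ _ ⟨
      (x - y) * (z - w)                        ∎

  ⟦⊖⟧ : ∀ m n → ⟦ m ⊖ n ⟧ ≈ ι m - ι n
  ⟦⊖⟧ m       zero    = sym (trans (+-congˡ -0#≈0#) (+-identityʳ _))
  ⟦⊖⟧ zero    (suc n) = sym (+-identityˡ _)
  ⟦⊖⟧ (suc m) (suc n) = begin
    ⟦ suc m ⊖ suc n ⟧        ≡⟨ ≡.cong ⟦_⟧ (ℤ.[1+m]⊖[1+n]≡m⊖n m n) ⟩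
    ⟦ m ⊖ n ⟧                ≈⟨ ⟦⊖⟧ m n ⟩
    ι m - ι n                ≈⟨ +-identityˡ _ ⟨
    0# + (ι m - ι n)         ≈⟨ +-congʳ (-‿inverseʳ 1#) ⟨
    (1# - 1#) + (ι m - ι n)  ≈⟨ [x+z]-[y+w]≈[x-y]+[z-w] 1# 1# (ι m) (ι n) ⟨
    (1# + ι m) - (1# + ι n)  ≈⟨ +-cong (1+× m 1#) (-‿cong (1+× n 1#)) ⟨
    ι (suc m) - ι (suc n)    ∎

  -- Every integer is a difference of naturals; the homomorphism laws are
  -- checked on such differences.
  private
    _⁺ _⁻ : ℤ → ℕ
    (+ n) ⁺    = n
    -[1+ n ] ⁺ = 0
    (+ n) ⁻    = 0
    -[1+ n ] ⁻ = suc n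

    ⁺⊖⁻ : ∀ i → i ≡ i ⁺ ⊖ i ⁻
    ⁺⊖⁻ (+ n)    = ≡.refl
    ⁺⊖⁻ -[1+ n ] = ≡.refl

    on-differences : {P : ℤ → Set ℓ} → (∀ a b → P (a ⊖ b)) → ∀ i → P i
    on-differences {P} h i = ≡.subst P (≡.sym (⁺⊖⁻ i)) (h (i ⁺) (i ⁻))

    on-differences₂ : {P : ℤ → ℤ → Set ℓ} →
                      (∀ a b c d → P (a ⊖ b) (c ⊖ d)) → ∀ i j → P i j
    on-differences₂ {P} h i j =
      ≡.subst₂ P (≡.sym (⁺⊖⁻ i)) (≡.sym (⁺⊖⁻ j)) (h (i ⁺) (i ⁻) (j ⁺) (j ⁻))

    ⟦⊖⟧-+ : ∀ a b c d → ⟦ (a ⊖ b) ℤ.+ (c ⊖ d) ⟧ ≈ ⟦ a ⊖ b ⟧ + ⟦ c ⊖ d ⟧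
    ⟦⊖⟧-+ a b c d = begin
      ⟦ (a ⊖ b) ℤ.+ (c ⊖ d) ⟧      ≡⟨ ≡.cong ⟦_⟧ (⊖-+-⊖ a b c d) ⟩
      ⟦ (a ℕ.+ c) ⊖ (b ℕ.+ d) ⟧    ≈⟨ ⟦⊖⟧ (a ℕ.+ c) (b ℕ.+ d) ⟩
      ι (a ℕ.+ c) - ι (b ℕ.+ d)    ≈⟨ +-cong (×-homo-+ 1# a c) (-‿cong (×-homo-+ 1# b d)) ⟩
      (ι a + ι c) - (ι b + ι d)    ≈⟨ [x+z]-[y+w]≈[x-y]+[z-w] _ _ _ _ ⟩
      (ι a - ι b) + (ι c - ι d)    ≈⟨ +-cong (⟦⊖⟧ a b) (⟦⊖⟧ c d) ⟨
      ⟦ a ⊖ b ⟧ + ⟦ c ⊖ d ⟧        ∎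

    ι-*-+-* : ∀ a b c d → ι (a ℕ.* b ℕ.+ c ℕ.* d) ≈ ι a * ι b + ι c * ι d
    ι-*-+-* a b c d =
      trans (×-homo-+ 1# (a ℕ.* b) (c ℕ.* d)) (+-cong (×1-homo-* a b) (×1-homo-* c d))

    ⟦⊖⟧-* : ∀ a b c d → ⟦ (a ⊖ b) ℤ.* (c ⊖ d) ⟧ ≈ ⟦ a ⊖ b ⟧ * ⟦ c ⊖ d ⟧
    ⟦⊖⟧-* a b c d = begin
      ⟦ (a ⊖ b) ℤ.* (c ⊖ d) ⟧
        ≡⟨ ≡.cong ⟦_⟧ (⊖-*-⊖ a b c d) ⟩
      ⟦ (a ℕ.* c ℕ.+ b ℕ.* d) ⊖ (a ℕ.* d ℕ.+ b ℕ.* c) ⟧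
        ≈⟨ ⟦⊖⟧ (a ℕ.* c ℕ.+ b ℕ.* d) (a ℕ.* d ℕ.+ b ℕ.* c) ⟩
      ι (a ℕ.* c ℕ.+ b ℕ.* d) - ι (a ℕ.* d ℕ.+ b ℕ.* c)
        ≈⟨ +-cong (ι-*-+-* a c b d) (-‿cong (ι-*-+-* a d b c)) ⟩
      (ι a * ι c + ι b * ι d) - (ι a * ι d + ι b * ι c)
        ≈⟨ [xz+yw]-[xw+yz]≈[x-y][z-w] _ _ _ _ ⟩
      (ι a - ι b) * (ι c - ι d)
        ≈⟨ *-cong (⟦⊖⟧ a b) (⟦⊖⟧ c d) ⟨
      ⟦ a ⊖ b ⟧ * ⟦ c ⊖ d ⟧ ∎

    ⟦⊖⟧-‿ : ∀ a b → ⟦ ℤ.- (a ⊖ b) ⟧ ≈ - ⟦ a ⊖ b ⟧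
    ⟦⊖⟧-‿ a b = begin
      ⟦ ℤ.- (a ⊖ b) ⟧  ≡⟨ ≡.cong ⟦_⟧ (≡.sym (ℤ.⊖-swap b a)) ⟩
      ⟦ b ⊖ a ⟧        ≈⟨ ⟦⊖⟧ b a ⟩
      ι b - ι a        ≈⟨ ⁻¹-anti-homo‿- (ι a) (ι b) ⟨
      - (ι a - ι b)    ≈⟨ -‿cong (⟦⊖⟧ a b) ⟨
      - ⟦ a ⊖ b ⟧      ∎

  ⟦⟧-homomorphism : ℤ.+-*-rawRing -Raw-AlmostCommutative⟶ fromCommutativeRing R
  ⟦⟧-homomorphism = record
    { ⟦_⟧    = ⟦_⟧
    ; +-homo = on-differences₂ ⟦⊖⟧-+
    ; *-homo = on-differences₂ ⟦⊖⟧-*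
    ; -‿homo = on-differences ⟦⊖⟧-‿
    ; 0-homo = refl
    ; 1-homo = refl
    }

  private
    ⟦⟧-weaklyDecidable : ∀ i j → Maybe (⟦ i ⟧ ≈ ⟦ j ⟧)
    ⟦⟧-weaklyDecidable i j with i ℤ.≟ j
    ... | yes i≡j = just (reflexive (≡.cong ⟦_⟧ i≡j))
    ... | no _    = nothing

  open Algebra.Solver.Ring ℤ.+-*-rawRing (fromCommutativeRing R)
                           ⟦⟧-homomorphism ⟦⟧-weaklyDecidable public
    using (Polynomial; solve; _:=_; _:+_; _:*_; _:-_; :-_; con)

module MatrixAlgebra {c ℓ : Level} (R : CommutativeRing c ℓ) where
  open CommutativeRing R
  open CommutativeRingSolver R
  open import Algebra.Properties.Ring ring using (-‿involutive; -‿injective)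
  open Mat2 public

  Matrix : Set c
  Matrix = Mat2 R

  infixl 7 _·_
  _·_ : Matrix → Matrix → Matrix
  _·_ = _⊗_ R

  infix 4 _≈ₘ_
  _≈ₘ_ : Matrix → Matrix → Set ℓ
  _≈ₘ_ = _≈M_ R

  ≈ₘ-refl : ∀ {X} → X ≈ₘ X
  ≈ₘ-refl = refl , refl , refl , refl

  ≈ₘ-sym : ∀ {X Y} → X ≈ₘ Y → Y ≈ₘ X
  ≈ₘ-sym (a , b , c , d) = sym a , sym b , sym c , sym d

  ≈ₘ-trans : ∀ {X Y Z} → X ≈ₘ Y → Y ≈ₘ Z → X ≈ₘ Z
  ≈ₘ-trans (a , b , c , d) (e , f , g , h) = trans a e , trans b f , trans c g , trans d h

  ≈ₘ-setoid : Setoid c ℓ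
  ≈ₘ-setoid = record
    { Carrier       = Matrix
    ; _≈_           = _≈ₘ_
    ; isEquivalence = record { refl = ≈ₘ-refl ; sym = ≈ₘ-sym ; trans = ≈ₘ-trans }
    }

  ⊗-cong : ∀ {X X′ Y Y′} → X ≈ₘ X′ → Y ≈ₘ Y′ → X · Y ≈ₘ X′ · Y′
  ⊗-cong (a , b , c , d) (e , f , g , h) =
    +-cong (*-cong a e) (*-cong b g) , +-cong (*-cong a f) (*-cong b h) ,
    +-cong (*-cong c e) (*-cong d g) , +-cong (*-cong c f) (*-cong d h)

  -- Matrices of solver polynomials, multiplied by the formula of _⊗_: the
  -- solver can then be given entries of matrix products without expanding them.
  private
    record PolyMatrix (n : ℕ) : Set where
      constructor pmat
      field p11 p12 p21 p22 : Polynomial n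
    open PolyMatrix

    infixl 7 _·ₚ_
    _·ₚ_ : ∀ {n} → PolyMatrix n → PolyMatrix n → PolyMatrix n
    pmat a b c d ·ₚ pmat e f g h =
      pmat (a :* e :+ b :* g) (a :* f :+ b :* h) (c :* e :+ d :* g) (c :* f :+ d :* h)

    Idₚ : ∀ {n} → PolyMatrix n
    Idₚ = pmat (con (+ 1)) (con (+ 0)) (con (+ 0)) (con (+ 1))

    Eₚ : ∀ {n} → Polynomial n → PolyMatrix n
    Eₚ a = pmat a (con -[1+ 0 ]) (con (+ 1)) (con (+ 0))

  ⊗-assoc : ∀ X Y Z → X · Y · Z ≈ₘ X · (Y · Z)
  ⊗-assoc (mat a b c d) (mat e f g h) (mat i j k l) =
      solve 12 (λ a b c d e f g h i j k l →
        p11 ([XY]Z a b c d e f g h i j k l) := p11 (X[YZ] a b c d e f g h i j k l))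
        refl a b c d e f g h i j k l
    , solve 12 (λ a b c d e f g h i j k l →
        p12 ([XY]Z a b c d e f g h i j k l) := p12 (X[YZ] a b c d e f g h i j k l))
        refl a b c d e f g h i j k l
    , solve 12 (λ a b c d e f g h i j k l →
        p21 ([XY]Z a b c d e f g h i j k l) := p21 (X[YZ] a b c d e f g h i j k l))
        refl a b c d e f g h i j k l
    , solve 12 (λ a b c d e f g h i j k l →
        p22 ([XY]Z a b c d e f g h i j k l) := p22 (X[YZ] a b c d e f g h i j k l))
        refl a b c d e f g h i j k l
    where
    [XY]Z X[YZ] : ∀ {n} (a b c d e f g h i j k l : Polynomial n) → PolyMatrix n
    [XY]Z a b c d e f g h i j k l = pmat a b c d ·ₚ pmat e f g h ·ₚ pmat i j k l
    X[YZ] a b c d e f g h i j k l = pmat a b c d ·ₚ (pmat e f g h ·ₚ pmat i j k l)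

  ⊗-identityˡ : ∀ X → Id R · X ≈ₘ X
  ⊗-identityˡ (mat a b c d) =
      solve 2 (λ a c → con (+ 1) :* a :+ con (+ 0) :* c := a) refl a c
    , solve 2 (λ b d → con (+ 1) :* b :+ con (+ 0) :* d := b) refl b d
    , solve 2 (λ a c → con (+ 0) :* a :+ con (+ 1) :* c := c) refl a c
    , solve 2 (λ b d → con (+ 0) :* b :+ con (+ 1) :* d := d) refl b d

  ⊗-identityʳ : ∀ X → X · Id R ≈ₘ X
  ⊗-identityʳ (mat a b c d) =
      solve 2 (λ a b → a :* con (+ 1) :+ b :* con (+ 0) := a) refl a b
    , solve 2 (λ a b → a :* con (+ 0) :+ b :* con (+ 1) := b) refl a b
    , solve 2 (λ c d → c :* con (+ 1) :+ d :* con (+ 0) := c) refl c d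
    , solve 2 (λ c d → c :* con (+ 0) :+ d :* con (+ 1) := d) refl c d

  det : Matrix → Carrier
  det (mat a b c d) = a * d - b * c

  det-⊗ : ∀ X Y → det (X · Y) ≈ det X * det Y
  det-⊗ (mat a b c d) (mat e f g h) = solve 8 (λ a b c d e f g h →
      (a :* e :+ b :* g) :* (c :* f :+ d :* h) :- (a :* f :+ b :* h) :* (c :* e :+ d :* g)
    := (a :* d :- b :* c) :* (e :* h :- f :* g)) refl a b c d e f g h

  det-Id : det (Id R) ≈ 1#
  det-Id = solve 0 (con (+ 1) :* con (+ 1) :- con (+ 0) :* con (+ 0) := con (+ 1)) refl

  det-E : ∀ a → det (E R a) ≈ 1#
  det-E = solve 1 (λ a → a :* con (+ 0) :- con -[1+ 0 ] :* con (+ 1) := con (+ 1)) refl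

  adj : Matrix → Matrix
  adj (mat a b c d) = mat d (- b) (- c) a

  adj-⊗ : ∀ X → adj X · X ≈ₘ mat (det X) 0# 0# (det X)
  adj-⊗ (mat a b c d) =
      solve 4 (λ a b c d → d :* a :+ (:- b) :* c := a :* d :- b :* c) refl a b c d
    , solve 2 (λ b d → d :* b :+ (:- b) :* d := con (+ 0)) refl b d
    , solve 2 (λ a c → (:- c) :* a :+ a :* c := con (+ 0)) refl a c
    , solve 4 (λ a b c d → (:- c) :* b :+ a :* d := a :* d :- b :* c) refl a b c d

  ⊗-adj : ∀ X → X · adj X ≈ₘ mat (det X) 0# 0# (det X)
  ⊗-adj (mat a b c d) =
      solve 4 (λ a b c d → a :* d :+ b :* (:- c) := a :* d :- b :* c) refl a b c d
    , solve 2 (λ a b → a :* (:- b) :+ b :* a := con (+ 0)) refl a b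
    , solve 2 (λ c d → c :* d :+ d :* (:- c) := con (+ 0)) refl c d
    , solve 4 (λ a b c d → c :* (:- b) :+ d :* a := a :* d :- b :* c) refl a b c d

  det≈1⇒adj-inverseˡ : ∀ {X} → det X ≈ 1# → adj X · X ≈ₘ Id R
  det≈1⇒adj-inverseˡ {X} det≈1 = ≈ₘ-trans (adj-⊗ X) (det≈1 , refl , refl , det≈1)

  det≈1⇒adj-inverseʳ : ∀ {X} → det X ≈ 1# → X · adj X ≈ₘ Id R
  det≈1⇒adj-inverseʳ {X} det≈1 = ≈ₘ-trans (⊗-adj X) (det≈1 , refl , refl , det≈1)

  det≈1⇒inverseˡ-unique : ∀ {X Y} → det X ≈ 1# → Y · X ≈ₘ Id R → Y ≈ₘ adj X
  det≈1⇒inverseˡ-unique {X} {Y} det≈1 YX≈I = begin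
    Y                ≈⟨ ⊗-identityʳ Y ⟨
    Y · Id R         ≈⟨ ⊗-cong ≈ₘ-refl (det≈1⇒adj-inverseʳ det≈1) ⟨
    Y · (X · adj X)  ≈⟨ ⊗-assoc Y X (adj X) ⟨
    Y · X · adj X    ≈⟨ ⊗-cong YX≈I ≈ₘ-refl ⟩
    Id R · adj X     ≈⟨ ⊗-identityˡ (adj X) ⟩
    adj X            ∎
    where open import Relation.Binary.Reasoning.Setoid ≈ₘ-setoid

  m11-⊗E⊗E : ∀ X x y → m11 (X · E R y · E R x) ≈ x * m11 (X · E R y) - m11 X
  m11-⊗E⊗E (mat p q r s) = solve 6 (λ p q r s x y →
      p11 (pmat p q r s ·ₚ Eₚ y ·ₚ Eₚ x) := x :* p11 (pmat p q r s ·ₚ Eₚ y) :- p) refl p q r s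

  M-pair : ∀ a b → M R (a ∷ b ∷ []) ≈ₘ mat (b * a - 1#) (- b) a (- 1#)
  M-pair a b =
      solve 2 (λ a b → p11 (EbEa a b) := b :* a :- con (+ 1)) refl a b
    , solve 2 (λ a b → p12 (EbEa a b) := :- b) refl a b
    , solve 2 (λ a b → p21 (EbEa a b) := a) refl a b
    , solve 2 (λ a b → p22 (EbEa a b) := :- con (+ 1)) refl a b
    where
    EbEa : ∀ {n} → Polynomial n → Polynomial n → PolyMatrix n
    EbEa a b = Idₚ ·ₚ Eₚ b ·ₚ Eₚ a

  pair-⊗≈Id⇒ : ∀ {X} a b → det X ≈ 1# → M R (a ∷ b ∷ []) · X ≈ₘ Id R →
               m11 X ≈ - 1# × a ≈ - m21 X × b ≈ m12 X
  pair-⊗≈Id⇒ a b det≈1 pairX≈I =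
    let _ , -b≈-q , a≈-r , -1≈p =
          ≈ₘ-trans (≈ₘ-sym (M-pair a b)) (det≈1⇒inverseˡ-unique det≈1 pairX≈I)
    in sym -1≈p , a≈-r , -‿injective -b≈-q

  pair-⊗≈Id⇐ : ∀ {X} → det X ≈ 1# → m11 X ≈ - 1# →
               M R (- m21 X ∷ m12 X ∷ []) · X ≈ₘ Id R
  pair-⊗≈Id⇐ {X@(mat p q r s)} det≈1 p≈-1 =
    ≈ₘ-trans (⊗-cong pair≈adj ≈ₘ-refl) (det≈1⇒adj-inverseˡ det≈1)
    where
    open import Relation.Binary.Reasoning.Setoid setoid

    q[-r]-1≈s : q * - r - 1# ≈ s
    q[-r]-1≈s = begin
      q * - r - 1#               ≈⟨ +-congˡ (-‿cong det≈1) ⟨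
      q * - r - (p * s - q * r)
        ≈⟨ solve 4 (λ p q r s → q :* (:- r) :- (p :* s :- q :* r) := (:- p) :* s) refl p q r s ⟩
      - p * s                    ≈⟨ *-congʳ (trans (-‿cong p≈-1) (-‿involutive 1#)) ⟩
      1# * s                     ≈⟨ *-identityˡ s ⟩
      s                          ∎

    pair≈adj : M R (- r ∷ q ∷ []) ≈ₘ adj X
    pair≈adj = ≈ₘ-trans (M-pair (- r) q) (q[-r]-1≈s , refl , refl , sym p≈-1)

module Continuants {c ℓ : Level} (R : CommutativeRing c ℓ) where
  open CommutativeRing R
  open MatrixAlgebra R
  open import Relation.Binary.Reasoning.Setoid setoid

  infix 4 _≋_
  _≋_ : ∀ {n} → Vec Carrier n → Vec Carrier n → Set (c ⊔ ℓ)
  _≋_ = Pointwise _≈_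

  ≋-refl : ∀ {n} {v : Vec Carrier n} → v ≋ v
  ≋-refl = Pointwise.refl refl

  ≋-reflexive : ∀ {n} {v w : Vec Carrier n} → v ≡ w → v ≋ w
  ≋-reflexive ≡.refl = ≋-refl

  ≋-trans : ∀ {n} {u v w : Vec Carrier n} → u ≋ v → v ≋ w → u ≋ w
  ≋-trans = Pointwise.trans trans

  M-cong : ∀ {n} {v w : Vec Carrier n} → v ≋ w → M R v ≈ₘ M R w
  M-cong Pointwise.[]          = ≈ₘ-refl
  M-cong (x≈y Pointwise.∷ v≋w) = ⊗-cong (M-cong v≋w) (x≈y , refl , refl , refl)

  M-++ : ∀ {m n} (v : Vec Carrier m) (w : Vec Carrier n) → M R (v ++ w) ≈ₘ M R w · M R v
  M-++ []      w = ≈ₘ-sym (⊗-identityʳ (M R w))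
  M-++ (x ∷ v) w = ≈ₘ-trans (⊗-cong (M-++ v w) ≈ₘ-refl) (⊗-assoc (M R w) (M R v) (E R x))

  det-M : ∀ {n} (v : Vec Carrier n) → det (M R v) ≈ 1#
  det-M []      = det-Id
  det-M (x ∷ v) = begin
    det (M R v · E R x)        ≈⟨ det-⊗ (M R v) (E R x) ⟩
    det (M R v) * det (E R x)  ≈⟨ *-cong (det-M v) (det-E x) ⟩
    1# * 1#                    ≈⟨ *-identityˡ 1# ⟩
    1#                         ∎

  m11-M≈K : ∀ {n} (v : Vec Carrier n) → m11 (M R v) ≈ K R v
  m11-M≈K []          = refl
  m11-M≈K (x ∷ [])    = proj₁ (⊗-identityˡ (E R x))
  m11-M≈K (x ∷ y ∷ v) = trans (m11-⊗E⊗E (M R v) x y)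
    (+-cong (*-congˡ (m11-M≈K (y ∷ v))) (-‿cong (m11-M≈K v)))

  M-++-pair≈Id⇒ : ∀ {n} (v : Vec Carrier n) a b → M R (v ++ a ∷ b ∷ []) ≈ₘ Id R →
                  K R v ≈ - 1# × a ≈ - m21 (M R v) × b ≈ m12 (M R v)
  M-++-pair≈Id⇒ v a b M≈I =
    let m11≈-1 , a≈-m21 , b≈m12 =
          pair-⊗≈Id⇒ a b (det-M v) (≈ₘ-trans (≈ₘ-sym (M-++ v (a ∷ b ∷ []))) M≈I)
    in trans (sym (m11-M≈K v)) m11≈-1 , a≈-m21 , b≈m12

  M-++-pair≈Id⇐ : ∀ {n} (v : Vec Carrier n) → K R v ≈ - 1# →
                  M R (v ++ - m21 (M R v) ∷ m12 (M R v) ∷ []) ≈ₘ Id R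
  M-++-pair≈Id⇐ v K≈-1 =
    ≈ₘ-trans (M-++ v _) (pair-⊗≈Id⇐ (det-M v) (trans (m11-M≈K v) K≈-1))

  alternatingScale : Carrier → Carrier → ∀ {n} → Vec Carrier n → Vec Carrier n
  alternatingScale l m []       = []
  alternatingScale l m (x ∷ xs) = l * x ∷ alternatingScale m l xs

  parityPower : Carrier → ℕ → Carrier
  parityPower l zero          = 1#
  parityPower l (suc zero)    = l
  parityPower l (suc (suc n)) = parityPower l n

  parityPower-odd : ∀ l k → parityPower l (suc (k ℕ.+ k)) ≡ l
  parityPower-odd l zero    = ≡.refl
  parityPower-odd l (suc k) rewrite +-suc k k = parityPower-odd l k

  inverse-comm : ∀ {l m} → l * m ≈ 1# → m * l ≈ 1#
  inverse-comm {l} {m} lm≈1 = trans (*-comm m l) lm≈1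

  *-parityPower-suc : ∀ {l m} → l * m ≈ 1# → ∀ n → l * parityPower m (suc n) ≈ parityPower l n
  *-parityPower-suc lm≈1 zero          = lm≈1
  *-parityPower-suc lm≈1 (suc zero)    = *-identityʳ _
  *-parityPower-suc lm≈1 (suc (suc n)) = *-parityPower-suc lm≈1 n

  K-alternatingScale : ∀ {l m} → l * m ≈ 1# → ∀ {n} (xs : Vec Carrier n) →
                       K R (alternatingScale l m xs) ≈ parityPower l n * K R xs
  K-alternatingScale lm≈1 []       = sym (*-identityʳ 1#)
  K-alternatingScale lm≈1 (x ∷ []) = refl
  K-alternatingScale {l} {m} lm≈1 {suc (suc n)} (x ∷ y ∷ xs) = begin
    l * x * K R (alternatingScale m l (y ∷ xs)) - K R (alternatingScale l m xs)
      ≈⟨ +-cong (*-congˡ (K-alternatingScale (inverse-comm lm≈1) (y ∷ xs)))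
                (-‿cong (K-alternatingScale lm≈1 xs)) ⟩
    l * x * (parityPower m (suc n) * K R (y ∷ xs)) - parityPower l n * K R xs
      ≈⟨ +-congʳ (*-interchange l x (parityPower m (suc n)) (K R (y ∷ xs))) ⟩
    l * parityPower m (suc n) * (x * K R (y ∷ xs)) - parityPower l n * K R xs
      ≈⟨ +-congʳ (*-congʳ (*-parityPower-suc lm≈1 n)) ⟩
    parityPower l n * (x * K R (y ∷ xs)) - parityPower l n * K R xs
      ≈⟨ x[y-z]≈xy-xz _ _ _ ⟨
    parityPower l n * (x * K R (y ∷ xs) - K R xs) ∎
    where
    open import Algebra.Properties.Ring ring using (x[y-z]≈xy-xz)
    open import Algebra.Properties.CommutativeSemigroup *-commutativeSemigroup
      using () renaming (interchange to *-interchange)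

  alternatingScale-cong : ∀ l m {n} {v w : Vec Carrier n} → v ≋ w →
                          alternatingScale l m v ≋ alternatingScale l m w
  alternatingScale-cong l m Pointwise.[]          = Pointwise.[]
  alternatingScale-cong l m (x≈y Pointwise.∷ v≋w) =
    *-congˡ x≈y Pointwise.∷ alternatingScale-cong m l v≋w

  alternatingScale-inverse : ∀ {l m} → l * m ≈ 1# → ∀ {n} (xs : Vec Carrier n) →
                             alternatingScale m l (alternatingScale l m xs) ≋ xs
  alternatingScale-inverse lm≈1 []                = Pointwise.[]
  alternatingScale-inverse {l} {m} lm≈1 (x ∷ xs) =
    trans (sym (*-assoc m l x)) (trans (*-congʳ (inverse-comm lm≈1)) (*-identityˡ x))
    Pointwise.∷ alternatingScale-inverse (inverse-comm lm≈1) xs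

module Correspondences {c ℓ : Level} (R : CommutativeRing c ℓ) where
  open CommutativeRing R
  open MatrixAlgebra R
  open Continuants R
  open import Relation.Binary.Reasoning.Setoid setoid

  SubSetoid-inverse : ∀ {m n} {P : Vec Carrier m → Set ℓ} {Q : Vec Carrier n → Set ℓ}
    (f : Vec Carrier m → Vec Carrier n) (g : Vec Carrier n → Vec Carrier m) →
    (∀ v → P v → Q (f v)) → (∀ w → Q w → P (g w)) →
    (∀ {v v′} → v ≋ v′ → f v ≋ f v′) → (∀ {w w′} → w ≋ w′ → g w ≋ g w′) →
    (∀ w → Q w → f (g w) ≋ w) → (∀ v → P v → g (f v) ≋ v) →
    Inverse (SubSetoid R m P) (SubSetoid R n Q)
  SubSetoid-inverse {m} {n} {P} {Q} f g f-pres g-pres f-cong g-cong fg≋id gf≋id = record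
    { to        = to
    ; from      = from
    ; to-cong   = f-cong
    ; from-cong = g-cong
    ; inverse   = (λ {(w , q)} v≋gw → ≋-trans (f-cong v≋gw) (fg≋id w q))
                , (λ {(v , p)} w≋fv → ≋-trans (g-cong w≋fv) (gf≋id v p))
    }
    where
    to : Σ (Vec Carrier m) P → Σ (Vec Carrier n) Q
    to (v , p) = f v , f-pres v p

    from : Σ (Vec Carrier n) Q → Σ (Vec Carrier m) P
    from (w , q) = g w , g-pres w q

  Rset⁻¹↔Ωset : ∀ n → Inverse (Rset R n (- 1#)) (Ωset R (n ℕ.+ 2))
  Rset⁻¹↔Ωset n = SubSetoid-inverse complete (take n)
    M-++-pair≈Id⇐ (λ w M≈I → proj₁ (complete-take w M≈I))
    complete-cong (take⁺ n)
    (λ w M≈I → proj₂ (complete-take w M≈I)) (λ v _ → ≋-reflexive (take-++ v _))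
    where
    complete : Vec Carrier n → Vec Carrier (n ℕ.+ 2)
    complete v = v ++ - m21 (M R v) ∷ m12 (M R v) ∷ []

    complete-cong : ∀ {v v′} → v ≋ v′ → complete v ≋ complete v′
    complete-cong v≋v′ =
      let _ , m12≈ , m21≈ , _ = M-cong v≋v′
      in ++⁺ v≋v′ (-‿cong m21≈ Pointwise.∷ m12≈ Pointwise.∷ Pointwise.[])

    complete-take : ∀ w → M R w ≈ₘ Id R → K R (take n w) ≈ - 1# × complete (take n w) ≋ w
    complete-take w M≈I with take n w | drop n w | take++drop≡id n w
    ... | v | a ∷ b ∷ [] | ≡.refl =
      let K≈-1 , a≈-m21 , b≈m12 = M-++-pair≈Id⇒ v a b M≈I
      in K≈-1 , ++⁺ ≋-refl (sym a≈-m21 Pointwise.∷ sym b≈m12 Pointwise.∷ Pointwise.[])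

  Rset-odd-scale : ∀ k {l m u u′} → l * m ≈ 1# → l * u ≈ u′ →
                   Inverse (Rset R (suc (k ℕ.+ k)) u) (Rset R (suc (k ℕ.+ k)) u′)
  Rset-odd-scale k {l} {m} {u} {u′} lm≈1 lu≈u′ = SubSetoid-inverse
    (alternatingScale l m) (alternatingScale m l) K-scale≈u′ K-unscale≈u
    (alternatingScale-cong l m) (alternatingScale-cong m l)
    (λ w _ → alternatingScale-inverse (inverse-comm lm≈1) w)
    (λ v _ → alternatingScale-inverse lm≈1 v)
    where
    K-scale≈u′ : ∀ (xs : Vec Carrier (suc (k ℕ.+ k))) →
                 K R xs ≈ u → K R (alternatingScale l m xs) ≈ u′
    K-scale≈u′ xs K≈u = begin
      K R (alternatingScale l m xs)            ≈⟨ K-alternatingScale lm≈1 xs ⟩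
      parityPower l (suc (k ℕ.+ k)) * K R xs   ≡⟨ ≡.cong (_* K R xs) (parityPower-odd l k) ⟩
      l * K R xs                               ≈⟨ *-congˡ K≈u ⟩
      l * u                                    ≈⟨ lu≈u′ ⟩
      u′                                       ∎

    K-unscale≈u : ∀ (xs : Vec Carrier (suc (k ℕ.+ k))) →
                  K R xs ≈ u′ → K R (alternatingScale m l xs) ≈ u
    K-unscale≈u xs K≈u′ = begin
      K R (alternatingScale m l xs)            ≈⟨ K-alternatingScale (inverse-comm lm≈1) xs ⟩
      parityPower m (suc (k ℕ.+ k)) * K R xs   ≡⟨ ≡.cong (_* K R xs) (parityPower-odd m k) ⟩
      m * K R xs                               ≈⟨ *-congˡ (trans K≈u′ (sym lu≈u′)) ⟩
      m * (l * u)                              ≈⟨ *-assoc m l u ⟨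
      m * l * u                                ≈⟨ *-congʳ (inverse-comm lm≈1) ⟩
      1# * u                                   ≈⟨ *-identityˡ u ⟩
      u                                        ∎

open import Data.Nat using (_+_)

lemma3p4 : {c ℓ : Level} (R : CommutativeRing c ℓ) (u : CommutativeRing.Carrier R) →
    IsUnit R u → (k : ℕ) →
    Bijection (Rset R (suc (k + k)) u) (Ωset R (suc (k + k) + 2))
lemma3p4 R u (v , uv≈1) k = Inverse⇒Bijection
  (Composition.inverse (Rset-odd-scale k [-v][-u]≈1 [-v]u≈-1) (Rset⁻¹↔Ωset (suc (k + k))))
  where
  open CommutativeRing R using (_*_; -_; _≈_; 1#; refl; trans; -‿cong)
  open CommutativeRingSolver R using (solve; _:=_; _:*_; :-_)
  open Correspondences R using (Rset-odd-scale; Rset⁻¹↔Ωset)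

  [-v][-u]≈1 : - v * - u ≈ 1#
  [-v][-u]≈1 = trans (solve 2 (λ u v → (:- v) :* (:- u) := u :* v) refl u v) uv≈1

  [-v]u≈-1 : - v * u ≈ - 1#
  [-v]u≈-1 = trans (solve 2 (λ u v → (:- v) :* u := :- (u :* v)) refl u v) (-‿cong uv≈1)
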